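{- Let $V$ be a countable set, let $\ell\geq 1$, and suppose each $v\in V$ has a list $L(v)$ of $\ell+1$ colours. Let $\mathcal X$ be a countable (possibly finite) collection of sets, such that each $X\in\mathcal X$ is an infinite set of pairs $(v,c)$ with $v\in V$ and $c\in L(v)$, where distinct pairs in $X$ have distinct first elements. Then there is a choice of $\ell$-element sublists $L'(v)\subset L(v)$, $v\in V$, such that for every $X\in\mathcal X$ there are infinitely many pairs $(v,c)\in X$ with $c\notin L'(v)$. -}

module Defs where

open import Level using (Level)
open import Data.Nat using (ℕ)
open import Data.Product using (Σ; _×_)
open import Data.Sum using (_⊎_)
open import Relation.Nullary using (¬_)
open import Function.Definitions using (Injective; Surjective)
open import Relation.Binary.PropositionalEquality using (_≡_)

Countable : Set → Set
Countable A = Σ (A → ℕ) (Injective _≡_ _≡_)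

-- A countable, possibly finite, (index) collection given constructively:
-- either empty, or enumerated (with repetitions allowed) by ℕ.
Enumerable : Set → Set
Enumerable A = (¬ A) ⊎ Σ (ℕ → A) (Surjective _≡_ _≡_)

Infinite : {A : Set} → (A → Set) → Set
Infinite {A} P = Σ (ℕ → A) λ f → (∀ n → P (f n)) × Injective _≡_ _≡_ f

-- Enumerate the pairs (X, k) with X ∈ 𝒳 and k ∈ ℕ along the anti-diagonals, so that every
-- X is visited infinitely often. At each visit, pick a pair (v, c) ∈ X whose vertex has a
-- larger code than all vertices picked before; this is possible because X has infinitely
-- many distinct first coordinates. The picked vertices are then pairwise distinct, so
-- deleting c from L(v) for every picked (v, c), and an arbitrary colour elsewhere, is a
-- consistent choice of the sublists L'(v), and each X keeps infinitely many deleted pairs.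
-- Since the picked codes increase, whether v has been picked is decidable by a bounded search.

module Submission where

open import Defs
open import Data.Nat using (ℕ; zero; suc; _+_; _≤_; _<_; _≤?_; _≟_; z≤n; s≤s)
open import Data.Nat.Properties
  using (≤-<-trans; <-trans; <-irrefl; <-cmp; ≰⇒>; n<1+n; m≤n⇒m<n∨m≡n;
         +-suc; +-identityʳ; suc-injective; anyUpTo?)
open import Data.Fin as Fin using (Fin; toℕ; fromℕ<)
open import Data.Fin.Properties using (any?; pigeonhole; toℕ-fromℕ<)
open import Data.Product using (Σ; ∃; ∃₂; _×_; _,_; proj₁; proj₂)
open import Data.Sum using (inj₁; inj₂)
open import Data.Empty using (⊥-elim)
open import Data.List using (List; _∷_; length)
open import Data.List.Properties using (length-removeAt′)
open import Data.List.Membership.Propositional using (_∈_; _∉_)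
open import Data.List.Relation.Binary.Subset.Propositional using (_⊆_)
open import Data.List.Relation.Unary.Any using (here; there; index; _─_)
open import Data.List.Relation.Unary.All using () renaming (lookup to All-lookup)
open import Data.List.Relation.Unary.All.Properties using (─⁺)
open import Data.List.Relation.Unary.AllPairs using (_∷_)
open import Data.List.Relation.Unary.Unique.Propositional using (Unique)
open import Data.List.Relation.Unary.Unique.Propositional.Properties using (Unique[x∷xs]⇒x∉xs)
open import Relation.Nullary using (Dec; yes; no; ¬_)
open import Relation.Nullary.Decidable using (map′)
open import Relation.Binary using (tri<; tri≈; tri>)
open import Relation.Binary.PropositionalEquality
  using (_≡_; refl; sym; trans; cong; subst; module ≡-Reasoning)
open import Function using (_∘_; id)
open import Function.Definitions using (Injective; Surjective)

module _ {C : Set} where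

  ─-⊆ : ∀ {x : C} {xs} (p : x ∈ xs) → (xs ─ p) ⊆ xs
  ─-⊆ (here _)  q         = there q
  ─-⊆ (there p) (here e)  = here e
  ─-⊆ (there p) (there q) = there (─-⊆ p q)

  Unique-─ : ∀ {x : C} {xs} (p : x ∈ xs) → Unique xs → Unique (xs ─ p)
  Unique-─ (here _)  (_ ∷ u)  = u
  Unique-─ (there p) (x≢ ∷ u) = ─⁺ p x≢ ∷ Unique-─ p u

  ∉-─ : ∀ {x : C} {xs} (p : x ∈ xs) → Unique xs → x ∉ (xs ─ p)
  ∉-─ (here refl) u                    = Unique[x∷xs]⇒x∉xs u
  ∉-─ (there p)   (y≢ ∷ _) (here refl) = All-lookup y≢ p refl
  ∉-─ (there p)   (_ ∷ u)  (there q)   = ∉-─ p u q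

  ─-shape : ∀ {x : C} {xs ℓ} (p : x ∈ xs) → Unique xs × length xs ≡ suc ℓ →
            (xs ─ p) ⊆ xs × Unique (xs ─ p) × length (xs ─ p) ≡ ℓ
  ─-shape {xs = xs} p (u , len) =
    ─-⊆ p , Unique-─ p u , suc-injective (trans (sym (length-removeAt′ xs (index p))) len)

  nonEmpty-∃∈ : ∀ {xs : List C} {ℓ} → length xs ≡ suc ℓ → ∃ (_∈ xs)
  nonEmpty-∃∈ {x ∷ _} _ = x , here refl

Infinite-map : {A B : Set} {P : A → Set} {Q : B → Set} (g : A → B) → Injective _≡_ _≡_ g →
               (∀ {a} → P a → Q (g a)) → Infinite P → Infinite Q
Infinite-map g g-injective P⇒Q (f , P∘f , f-injective) =
  g ∘ f , P⇒Q ∘ P∘f , λ eq → f-injective (g-injective eq)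

injective⇒unbounded : (g : ℕ → ℕ) → Injective _≡_ _≡_ g → ∀ B → ∃ λ n → B ≤ g n
injective⇒unbounded g g-injective B with any? {n = suc B} (λ k → B ≤? g (toℕ k))
... | yes (k , B≤gk) = toℕ k , B≤gk
... | no ∄k = ⊥-elim (collision (pigeonhole (n<1+n B) below))
  where
  open ≡-Reasoning
  below : Fin (suc B) → Fin B
  below k = fromℕ< (≰⇒> (λ B≤gk → ∄k (k , B≤gk)))
  collision : ¬ (∃₂ λ i j → i Fin.< j × below i ≡ below j)
  collision (i , j , i<j , below-i≡below-j) = <-irrefl (g-injective (begin
    g (toℕ i)      ≡⟨ toℕ-fromℕ< _ ⟨
    toℕ (below i)  ≡⟨ cong toℕ below-i≡below-j ⟩
    toℕ (below j)  ≡⟨ toℕ-fromℕ< _ ⟩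
    g (toℕ j)      ∎)) i<j

StrictlyIncreasing : (ℕ → ℕ) → Set
StrictlyIncreasing h = ∀ s → h s < h (suc s)

module _ {h : ℕ → ℕ} (h-increasing : StrictlyIncreasing h) where

  strictlyIncreasing⇒< : ∀ {s t} → s < t → h s < h t
  strictlyIncreasing⇒< {s} {suc t} (s≤s s≤t) with m≤n⇒m<n∨m≡n s≤t
  ... | inj₁ s<t  = <-trans (strictlyIncreasing⇒< s<t) (h-increasing t)
  ... | inj₂ refl = h-increasing s

  strictlyIncreasing⇒injective : Injective _≡_ _≡_ h
  strictlyIncreasing⇒injective {s} {t} eq with <-cmp s t
  ... | tri< s<t _ _ = ⊥-elim (<-irrefl eq (strictlyIncreasing⇒< s<t))
  ... | tri≈ _ s≡t _ = s≡t
  ... | tri> _ _ t<s = ⊥-elim (<-irrefl (sym eq) (strictlyIncreasing⇒< t<s))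

  strictlyIncreasing⇒inflationary : ∀ s → s ≤ h s
  strictlyIncreasing⇒inflationary zero    = z≤n
  strictlyIncreasing⇒inflationary (suc s) =
    ≤-<-trans (strictlyIncreasing⇒inflationary s) (h-increasing s)

  strictlyIncreasing-range? : ∀ k → Dec (∃ λ s → h s ≡ k)
  strictlyIncreasing-range? k =
    map′ (λ (s , _ , hs≡k) → s , hs≡k)
         (λ (s , hs≡k) → s , s≤s (subst (s ≤_) hs≡k (strictlyIncreasing⇒inflationary s)) , hs≡k)
         (anyUpTo? (λ s → h s ≟ k) (suc k))

-- Cantor's enumeration of ℕ × ℕ: the anti-diagonal a + b = n is traversed from (n , 0) to (0 , n).
nextPair : ℕ × ℕ → ℕ × ℕ
nextPair (zero  , b) = suc b , zero
nextPair (suc a , b) = a , suc b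

unpair : ℕ → ℕ × ℕ
unpair zero    = zero , zero
unpair (suc s) = nextPair (unpair s)

unpair-walk : ∀ k s {a b} → unpair s ≡ (k + a , b) → unpair (k + s) ≡ (a , k + b)
unpair-walk zero    s eq = eq
unpair-walk (suc k) s {a} {b} eq = begin
  unpair (suc k + s)     ≡⟨ cong unpair (+-suc k s) ⟨
  unpair (k + suc s)     ≡⟨ unpair-walk k (suc s) (cong nextPair eq) ⟩
  (a , k + suc b)        ≡⟨ cong (a ,_) (+-suc k b) ⟩
  (a , suc k + b)        ∎
  where open ≡-Reasoning

unpair-diagonal : ∀ n → ∃ λ s → unpair s ≡ (n , zero)
unpair-diagonal zero    = zero , refl
unpair-diagonal (suc n) with s , eq ← unpair-diagonal n = suc (n + s) , (begin
  nextPair (unpair (n + s))  ≡⟨ cong nextPair (unpair-walk n s (trans eq (cong (_, zero) (sym (+-identityʳ n))))) ⟩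
  nextPair (zero , n + zero) ≡⟨ cong (λ m → suc m , zero) (+-identityʳ n) ⟩
  (suc n , zero)             ∎)
  where open ≡-Reasoning

unpair-surjective : ∀ a b → ∃ λ s → unpair s ≡ (a , b)
unpair-surjective a b with s , eq ← unpair-diagonal (b + a) =
  b + s , trans (unpair-walk b s eq) (cong (a ,_) (+-identityʳ b))

unpair-fibre-infinite : ∀ a → Infinite (λ s → proj₁ (unpair s) ≡ a)
unpair-fibre-infinite a = visit , (λ t → cong proj₁ (visited t)) , visit-injective
  where
  visit : ℕ → ℕ
  visit t = proj₁ (unpair-surjective a t)
  visited : ∀ t → unpair (visit t) ≡ (a , t)
  visited t = proj₂ (unpair-surjective a t)
  visit-injective : Injective _≡_ _≡_ visit
  visit-injective {t} {t′} eq = cong proj₂ (trans (sym (visited t)) (trans (cong unpair eq) (visited t′)))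

module IncreasingSelection {A : Set} (P : ℕ → A → Set) (size : A → ℕ)
  (unbounded : ∀ s B → Σ A λ a → P s a × B ≤ size a) where

  private
    lowerBound : ℕ → ℕ
    lowerBound zero    = zero
    lowerBound (suc s) = suc (size (proj₁ (unbounded s (lowerBound s))))

  select : ℕ → A
  select s = proj₁ (unbounded s (lowerBound s))

  select-∈ : ∀ s → P s (select s)
  select-∈ s = proj₁ (proj₂ (unbounded s (lowerBound s)))

  select-increasing : StrictlyIncreasing (size ∘ select)
  select-increasing s = proj₂ (proj₂ (unbounded (suc s) (lowerBound (suc s))))

infiniteGraph⇒unbounded : {V C : Set} (code : V → ℕ) → Injective _≡_ _≡_ code →
  {P : V × C → Set} → (∀ v c c′ → P (v , c) → P (v , c′) → c ≡ c′) → Infinite P →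
  ∀ B → Σ (V × C) λ p → P p × B ≤ code (proj₁ p)
infiniteGraph⇒unbounded code code-injective {P} functional (f , P∘f , f-injective) B =
  let n , B≤ = injective⇒unbounded (code ∘ proj₁ ∘ f) vertexCode-injective B in f n , P∘f n , B≤
  where
  sameVertex⇒≡ : ∀ {p q} → P p → P q → proj₁ p ≡ proj₁ q → p ≡ q
  sameVertex⇒≡ {v , c} {_ , c′} Pp Pq refl = cong (v ,_) (functional v c c′ Pp Pq)
  vertexCode-injective : Injective _≡_ _≡_ (code ∘ proj₁ ∘ f)
  vertexCode-injective {m} {n} eq = f-injective (sameVertex⇒≡ (P∘f m) (P∘f n) (code-injective eq))

module Construction
  {V C I : Set} (code : V → ℕ) (code-injective : Injective _≡_ _≡_ code)
  {ℓ : ℕ} (L : V → List C) (L-shape : ∀ v → Unique (L v) × length (L v) ≡ suc ℓ)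
  (enum : ℕ → I) (enum-surjective : Surjective _≡_ _≡_ enum)
  (X : I → V × C → Set) (X⊆L : ∀ i v c → X i (v , c) → c ∈ L v)
  (X-functional : ∀ i v c c′ → X i (v , c) → X i (v , c′) → c ≡ c′)
  (X-infinite : ∀ i → Infinite (X i)) where

  schedule : ℕ → I
  schedule s = enum (proj₁ (unpair s))

  open IncreasingSelection (X ∘ schedule) (code ∘ proj₁)
    (λ s → infiniteGraph⇒unbounded code code-injective (X-functional (schedule s)) (X-infinite (schedule s)))

  vertex : ℕ → V
  vertex = proj₁ ∘ select

  colour : ℕ → C
  colour = proj₂ ∘ select

  select-injective : Injective _≡_ _≡_ select
  select-injective {s} {t} eq = strictlyIncreasing⇒injective select-increasing {s} {t} (cong (code ∘ proj₁) eq)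

  PickedVertex : V → Set
  PickedVertex v = ∃ λ s → code (vertex s) ≡ code v

  picked? : ∀ v → Dec (PickedVertex v)
  picked? v = strictlyIncreasing-range? select-increasing (code v)

  discardedIf : ∀ v → Dec (PickedVertex v) → ∃ (_∈ L v)
  discardedIf v (yes (s , eq)) =
    colour s , subst (λ w → colour s ∈ L w) (code-injective eq) (X⊆L _ _ _ (select-∈ s))
  discardedIf v (no _)         = nonEmpty-∃∈ (proj₂ (L-shape v))

  discardedIf-vertex : ∀ s d → proj₁ (discardedIf (vertex s) d) ≡ colour s
  discardedIf-vertex s (yes (s′ , eq)) =
    cong colour (strictlyIncreasing⇒injective select-increasing {s′} {s} eq)
  discardedIf-vertex s (no ∄s)         = ⊥-elim (∄s (s , refl))

  discarded : ∀ v → ∃ (_∈ L v)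
  discarded v = discardedIf v (picked? v)

  L′ : V → List C
  L′ v = L v ─ proj₂ (discarded v)

  L′-shape : ∀ v → L′ v ⊆ L v × Unique (L′ v) × length (L′ v) ≡ ℓ
  L′-shape v = ─-shape (proj₂ (discarded v)) (L-shape v)

  colour∉L′ : ∀ s → colour s ∉ L′ (vertex s)
  colour∉L′ s = subst (_∉ L′ (vertex s)) (discardedIf-vertex s (picked? (vertex s)))
                      (∉-─ (proj₂ (discarded (vertex s))) (proj₁ (L-shape (vertex s))))

  schedule-fibre-infinite : ∀ i → Infinite (λ s → schedule s ≡ i)
  schedule-fibre-infinite i with j , j↦i ← enum-surjective i =
    Infinite-map {Q = λ s → schedule s ≡ i} id id j↦i (unpair-fibre-infinite j)

  discarded-infinite : ∀ i → Infinite (λ p → X i p × proj₂ p ∉ L′ (proj₁ p))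
  discarded-infinite i =
    Infinite-map {P = λ s → schedule s ≡ i} {Q = λ p → X i p × proj₂ p ∉ L′ (proj₁ p)}
      select select-injective
      (λ {s} eq → subst (λ i′ → X i′ (select s)) eq (select-∈ s) , colour∉L′ s)
      (schedule-fibre-infinite i)

lemma10 : (V : Set) → Countable V → (C : Set) → (ℓ : ℕ) → 1 ≤ ℓ →
          (L : V → List C) → (∀ v → Unique (L v) × length (L v) ≡ suc ℓ) →
          (I : Set) → Enumerable I → (X : I → V × C → Set) →
          (∀ i v c → X i (v , c) → c ∈ L v) →
          (∀ i v c c′ → X i (v , c) → X i (v , c′) → c ≡ c′) →
          (∀ i → Infinite (X i)) →
          Σ (V → List C) λ L′ →
            (∀ v → L′ v ⊆ L v × Unique (L′ v) × length (L′ v) ≡ ℓ) ×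
            (∀ i → Infinite (λ p → X i p × proj₂ p ∉ L′ (proj₁ p)))
lemma10 V _ C ℓ _ L L-shape I (inj₁ ∄i) X _ _ _ =
  (λ v → L v ─ proj₂ (someColour v)) , (λ v → ─-shape (proj₂ (someColour v)) (L-shape v)) ,
  λ i → ⊥-elim (∄i i)
  where
  someColour : ∀ v → ∃ (_∈ L v)
  someColour v = nonEmpty-∃∈ (proj₂ (L-shape v))
lemma10 V (code , code-injective) C ℓ _ L L-shape I (inj₂ (enum , enum-surjective)) X X⊆L X-functional X-infinite =
  L′ , L′-shape , discarded-infinite
  where open Construction code code-injective L L-shape enum enum-surjective X X⊆L X-functional X-infinite
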